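{- Let $P$ be a poset and $Q$ a down finite poset. Then for every large $f\in\mathrm{Pro}(P,Q)$, the open set $U(\mathbf{0},f)=\{g\in\mathrm{Pro}(P,Q): g\le f\}$ is also closed.
   Context: $Q$ is down finite if $\{q'\,:\,q'\le q\}$ is finite for every $q\in Q$. $\widehat{Q}$ is the set of down-sets of $Q$ ordered by inclusion. A profunctor $f:P\to Q$ is an order-preserving map $f:P\to\widehat{Q}$; $\mathrm{Pro}(P,Q)$ is ordered pointwise by inclusion; $\mathbf{0}(p)=\emptyset$ for all $p$. $f$ is large if $\{p: f(p)\neq Q\}$ is finite, small if $\bigcup_p f(p)$ is finite. The topology on $\mathrm{Pro}(P,Q)$ has as basis the sets $U(g,h)=\{f: g\le f\le h\}$ with $g$ small and $h$ large. -}

module Defs where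

open import Level using (Level; _⊔_; Lift) renaming (suc to lsuc)
open import Data.Product using (Σ; ∃; _×_; _,_)
open import Data.List using (List)
open import Data.List.Relation.Unary.Any using (Any)
open import Data.Empty using (⊥)
open import Relation.Nullary using (¬_)
open import Relation.Binary.Bundles using (Poset)

module _ {b ℓ₃ ℓ₄ : Level} (Q : Poset b ℓ₃ ℓ₄) where
  open Poset Q

  _∈L_ : Carrier → List Carrier → Set (b ⊔ ℓ₃)
  x ∈L xs = Any (x ≈_) xs

  FiniteSubset : ∀ {r} → (Carrier → Set r) → Set (b ⊔ ℓ₃ ⊔ r)
  FiniteSubset S = Σ (List Carrier) λ xs → ∀ x → S x → x ∈L xs

  DownFinite : Set (b ⊔ ℓ₃ ⊔ ℓ₄)
  DownFinite = ∀ q → FiniteSubset (λ q' → q' ≤ q)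

  -- Down-sets of Q (elements of Q̂), as predicates at level r
  record DownSet (r : Level) : Set (b ⊔ ℓ₄ ⊔ lsuc r) where
    field
      mem       : Carrier → Set r
      down-closed : ∀ {q q'} → q' ≤ q → mem q → mem q'
  open DownSet public

  _⊆D_ : ∀ {r} → DownSet r → DownSet r → Set (b ⊔ r)
  D ⊆D E = ∀ q → mem D q → mem E q

  IsFull : ∀ {r} → DownSet r → Set (b ⊔ r)
  IsFull D = ∀ q → mem D q

-- Profunctors P → Q : order-preserving maps P → Q̂
module _ {a ℓ₁ ℓ₂ b ℓ₃ ℓ₄ : Level} (P : Poset a ℓ₁ ℓ₂) (Q : Poset b ℓ₃ ℓ₄) (r : Level) where
  private
    module P = Poset P
    module Q = Poset Q

  record Pro : Set (a ⊔ ℓ₂ ⊔ b ⊔ ℓ₄ ⊔ lsuc r) where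
    field
      app  : P.Carrier → DownSet Q r
      mono : ∀ {p p'} → p P.≤ p' → _⊆D_ Q (app p) (app p')
  open Pro public

module _ {a ℓ₁ ℓ₂ b ℓ₃ ℓ₄ : Level} {P : Poset a ℓ₁ ℓ₂} {Q : Poset b ℓ₃ ℓ₄} {r : Level} where
  private
    module P = Poset P
    module Q = Poset Q

  _≤Pro_ : Pro P Q r → Pro P Q r → Set (a ⊔ b ⊔ r)
  f ≤Pro g = ∀ p → _⊆D_ Q (app f p) (app g p)

  𝟎 : Pro P Q r
  𝟎 = record
    { app  = λ p → record { mem = λ _ → Lift r ⊥ ; down-closed = λ _ () }
    ; mono = λ _ q x → x }

  Large : Pro P Q r → Set (a ⊔ ℓ₁ ⊔ b ⊔ r)
  Large f = FiniteSubset P (λ p → ¬ IsFull Q (app f p))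

  Small : Pro P Q r → Set (a ⊔ b ⊔ ℓ₃ ⊔ r)
  Small f = FiniteSubset Q (λ q → ∃ λ p → mem (app f p) q)

  U : Pro P Q r → Pro P Q r → Pro P Q r → Set (a ⊔ b ⊔ r)
  U g h f = (g ≤Pro f) × (f ≤Pro h)

  IsOpen : ∀ {s} → (Pro P Q r → Set s) → Set (a ⊔ ℓ₁ ⊔ ℓ₂ ⊔ b ⊔ ℓ₃ ⊔ ℓ₄ ⊔ lsuc r ⊔ s)
  IsOpen S = ∀ k → S k → Σ (Pro P Q r) λ g → Σ (Pro P Q r) λ h →
               Small g × Large h × U g h k × (∀ k' → U g h k' → S k')

  IsClosed : ∀ {s} → (Pro P Q r → Set s) → Set (a ⊔ ℓ₁ ⊔ ℓ₂ ⊔ b ⊔ ℓ₃ ⊔ ℓ₄ ⊔ lsuc r ⊔ s)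
  IsClosed S = IsOpen (λ k → ¬ S k)

module Submission where

open import Defs
open import Level using (Level; Lift; lift; lower)
open import Axiom.ExcludedMiddle using (ExcludedMiddle)
open import Relation.Binary.Bundles using (Poset)
open import Relation.Nullary using (¬_; yes; no)
open import Relation.Nullary.Decidable using (True; toWitness; fromWitness)
open import Data.Product using (∃; _×_; _,_; proj₁)
open import Data.Unit using (⊤)
open import Data.Empty using (⊥-elim)
open import Data.List using ([])
open import Function using (_∘_)

-- If k ∉ U(𝟎, f), some q ∈ k(p) is missing from f(p). The principal profunctor
-- p' ↦ (p ≤ p' ? ↓q : ∅) is small because ↓q is finite, lies below k and contains q at p,
-- so U(principal, full) is a basic neighbourhood of k disjoint from U(𝟎, f).

module _ (lem : ∀ {ℓ} → ExcludedMiddle ℓ) where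

  -- Needed because the down-sets of Pro P Q r live at the fixed level r.
  Resized : ∀ {ℓ} (r : Level) → Set ℓ → Set r
  Resized r A = Lift r (True (lem {P = A}))

  resize : ∀ {ℓ r} {A : Set ℓ} → A → Resized r A
  resize = lift ∘ fromWitness

  unresize : ∀ {ℓ r} {A : Set ℓ} → Resized r A → A
  unresize = toWitness ∘ lower

module _ {a ℓ₁ ℓ₂ b ℓ₃ ℓ₄ r : Level} (P : Poset a ℓ₁ ℓ₂) (Q : Poset b ℓ₃ ℓ₄) where
  private
    module P = Poset P
    module Q = Poset Q

  𝟎-least : (k : Pro P Q r) → 𝟎 ≤Pro k
  𝟎-least k p q ()

  full : Pro P Q r
  full = record
    { app  = λ _ → record { mem = λ _ → Lift r ⊤ ; down-closed = λ _ q∈Q → q∈Q }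
    ; mono = λ _ _ q∈Q → q∈Q }

  full-large : Large full
  full-large = [] , λ p full≠Q → ⊥-elim (full≠Q (λ _ → _))

  full-greatest : (k : Pro P Q r) → k ≤Pro full
  full-greatest k p q _ = _

  module _ (lem : ∀ {ℓ} → ExcludedMiddle ℓ) where

    ¬≤Pro⇒∃-outside : {k f : Pro P Q r} → ¬ (k ≤Pro f) →
                      ∃ λ p → ∃ λ q → mem (app k p) q × ¬ mem (app f p) q
    ¬≤Pro⇒∃-outside {k} {f} k≰f
      with lem {P = ∃ λ p → ∃ λ q → mem (app k p) q × ¬ mem (app f p) q}
    ... | yes outside = outside
    ... | no nothing-outside = ⊥-elim (k≰f k≤f)
      where
      k≤f : k ≤Pro f
      k≤f p q q∈kp with lem {P = mem (app f p) q}
      ... | yes q∈fp = q∈fp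
      ... | no q∉fp = ⊥-elim (nothing-outside (p , q , q∈kp , q∉fp))

    principal : P.Carrier → Q.Carrier → Pro P Q r
    principal p q = record
      { app  = λ p' → record
          { mem         = λ q' → Resized lem r (q' Q.≤ q × p P.≤ p')
          ; down-closed = λ q₂≤q₁ q₁∈ → let (q₁≤q , p≤p') = unresize lem q₁∈
                                        in resize lem (Q.trans q₂≤q₁ q₁≤q , p≤p') }
      ; mono = λ p₁≤p₂ q' q'∈ → let (q'≤q , p≤p₁) = unresize lem q'∈
                                in resize lem (q'≤q , P.trans p≤p₁ p₁≤p₂) }

    principal-∋ : ∀ p q → mem (app (principal p q) p) q
    principal-∋ p q = resize lem (Q.refl , P.refl)

    principal-small : DownFinite Q → ∀ p q → Small (principal p q)
    principal-small down-finite p q =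
      let (↓q , ↓q-covers) = down-finite q
      in ↓q , λ q' (p' , q'∈) → ↓q-covers q' (proj₁ (unresize lem q'∈))

    principal-≤Pro : (k : Pro P Q r) → ∀ {p q} → mem (app k p) q → principal p q ≤Pro k
    principal-≤Pro k {p} q∈kp p' q' q'∈ =
      let (q'≤q , p≤p') = unresize lem q'∈
      in mono k p≤p' q' (down-closed (app k p) q'≤q q∈kp)

lemma6p5 : (lem : ∀ {ℓ} → ExcludedMiddle ℓ)
    → ∀ {a ℓ₁ ℓ₂ b ℓ₃ ℓ₄ r : Level} (P : Poset a ℓ₁ ℓ₂) (Q : Poset b ℓ₃ ℓ₄)
    → DownFinite Q
    → (f : Pro P Q r) → Large f
    → IsClosed (U (𝟎 {P = P} {Q = Q} {r = r}) f)
lemma6p5 lem P Q down-finite f _ k k∉U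
  with ¬≤Pro⇒∃-outside P Q lem {k} {f} (λ k≤f → k∉U (𝟎-least P Q k , k≤f))
... | p , q , q∈kp , q∉fp =
  g , full P Q , principal-small P Q lem down-finite p q , full-large P Q ,
  (principal-≤Pro P Q lem k q∈kp , full-greatest P Q k) , disjoint
  where
  g : Pro P Q _
  g = principal P Q lem p q

  disjoint : ∀ k' → U g (full P Q) k' → ¬ U 𝟎 f k'
  disjoint k' (g≤k' , _) (_ , k'≤f) = q∉fp (k'≤f p q (g≤k' p q (principal-∋ P Q lem p q)))
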